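{- For every $n\ge0$, $$\varphi(R(Y_n))=\{P\cup K(P)\mid P\in\mathrm{NCP}_n\}.$$
   Context: Planar binary trees: $Y_0=\{|\}$, $Y_n=\{\sigma\vee\tau:\sigma\in Y_k,\tau\in Y_l,k+l=n-1\}$ for $n\ge1$, where $\sigma\vee\tau$ is the tree whose root has left subtree $\sigma$ and right subtree $\tau$; $Y=\bigcup_n Y_n$. $R:Y\to Y$ is defined by $R(|)=|$, $R(\sigma\vee\tau)=(|\vee R(\sigma))\vee R(\tau)$, so $R(Y_n)\subseteq Y_{2n}$. Noncrossing partitions: $\mathrm{NCP}_n$ is the set of noncrossing partitions of $[n]=\{1,\dots,n\}$, $\mathrm{NCP}_0=\{\emptyset\}$, and $|$ denotes the unique partition in $\mathrm{NCP}_1$. For $P\in\mathrm{NCP}_m,Q\in\mathrm{NCP}_{n}$, $P*Q\in\mathrm{NCP}_{m+n}$ is the concatenation (blocks of $P$ together with blocks of $Q$ shifted by $m$); $P\,\underline{*}\,Q$ is obtained from $P*Q$ by merging the last block of $P$ (the one containing $m$) with the last block of shifted $Q$ (containing $m+n$), with $P\,\underline*\,Q=P*Q$ if $P$ or $Q$ is empty. The map $\varphi:Y\to\mathrm{NCP}$ is defined recursively by $\varphi(|)=\emptyset$ and $\varphi(\sigma\vee\tau)=\varphi(\sigma)*(|\,\underline*\,\varphi(\tau))$. Equivalently, numbering the vertices of $\tau\in Y_n$ by $1,\dots,n$ in left-to-right (in-order) order, $\varphi(\tau)$ is the partition generated by the relation "$x$ is the right child of $y$". For $P,Q\in\mathrm{NCP}_n$,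 $P\cup Q$ is the partition of $[2n]$ with blocks $\{2i-1:i\in V\}$ for $V\in P$ and $\{2i:i\in W\}$ for $W\in Q$. The Kreweras complement $K(P)$ of $P\in\mathrm{NCP}_n$ is the largest $Q\in\mathrm{NCP}_n$ (for the refinement order, $Q\le Q'$ if every block of $Q$ lies in a block of $Q'$) such that $P\cup Q$ is noncrossing. -}

module Defs where

open import Data.Nat using (ℕ; zero; suc; _+_; _∸_; _<_; _<ᵇ_; ⌊_/2⌋)
open import Data.Bool using (Bool; true; false; _∧_; _∨_; not; if_then_else_)
open import Data.Product using (Σ; _×_; ∃; ∃-syntax; _,_; proj₁)
open import Relation.Binary.PropositionalEquality using (_≡_)

-- Planar binary trees.  Y_n = trees with  size τ ≡ n  (size = number of
-- internal vertices).

data Tree : Set where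
  leaf : Tree
  _∨ᵗ_ : Tree → Tree → Tree

size : Tree → ℕ
size leaf = 0
size (σ ∨ᵗ τ) = suc (size σ + size τ)

R : Tree → Tree
R leaf = leaf
R (σ ∨ᵗ τ) = (leaf ∨ᵗ R σ) ∨ᵗ R τ

-- We use 0-based points {0,…,n-1} (point k stands
-- for k+1 ∈ [n]).  A partition is represented by its (decidable)
-- "same block" relation; only its values on points < n matter.

Rel₂ : Set
Rel₂ = ℕ → ℕ → Bool

record IsPartition (n : ℕ) (r : Rel₂) : Set where
  field
    refl′  : ∀ a → a < n → r a a ≡ true
    sym′   : ∀ a b → a < n → b < n → r a b ≡ true → r b a ≡ true
    trans′ : ∀ a b c → a < n → b < n → c < n →
             r a b ≡ true → r b c ≡ true → r a c ≡ true

NonCrossing : ℕ → Rel₂ → Set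
NonCrossing n r = ∀ a b c d → a < b → b < c → c < d → d < n →
  r a c ≡ true → r b d ≡ true → r a b ≡ true

NCP : ℕ → Set
NCP n = Σ Rel₂ λ r → IsPartition n r × NonCrossing n r

EqOn : ℕ → Rel₂ → Rel₂ → Set
EqOn n r s = ∀ a b → a < n → b < n → r a b ≡ s a b

Refines : ℕ → Rel₂ → Rel₂ → Set
Refines n r s = ∀ a b → a < n → b < n → r a b ≡ true → s a b ≡ true

∅ᵖ : Rel₂
∅ᵖ _ _ = false

∣ᵖ : Rel₂
∣ᵖ _ _ = true

concat : ℕ → Rel₂ → Rel₂ → Rel₂
concat m P Q a b =
  if (a <ᵇ m) ∧ (b <ᵇ m) then P a b
  else if not (a <ᵇ m) ∧ not (b <ᵇ m) then Q (a ∸ m) (b ∸ m)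
  else false

-- P \underline{*} Q  for P a partition of [m], Q a partition of [n]:
-- merge the block of P containing its last point with the block of
-- shifted Q containing its last point; equal to P * Q if m = 0 or n = 0.
merge : ℕ → ℕ → Rel₂ → Rel₂ → Rel₂
merge zero n P Q = concat zero P Q
merge (suc m) zero P Q = concat (suc m) P Q
merge (suc m) (suc n) P Q a b =
  concat (suc m) P Q a b ∨ ((lastP a ∨ lastQ a) ∧ (lastP b ∨ lastQ b))
  where
  lastP : ℕ → Bool
  lastP x = (x <ᵇ suc m) ∧ P x m
  lastQ : ℕ → Bool
  lastQ x = not (x <ᵇ suc m) ∧ Q (x ∸ suc m) n

-- φ : Y → NCP,  φ(|) = ∅,  φ(σ ∨ τ) = φ(σ) * (| \underline{*} φ(τ));
-- φ τ is a partition of [size τ].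
φ : Tree → Rel₂
φ leaf = ∅ᵖ
φ (σ ∨ᵗ τ) = concat (size σ) (φ σ) (merge 1 (size τ) ∣ᵖ (φ τ))

-- parity (0-based: point 2i is the 1-based odd point 2i+1)
even : ℕ → Bool
even zero = true
even (suc n) = not (even n)

-- P ∪ Q on [2n]: P on the odd (1-based) points 2i-1, Q on the even ones 2i
_∪ᵖ_ : Rel₂ → Rel₂ → Rel₂
(P ∪ᵖ Q) a b =
  if even a ∧ even b then P ⌊ a /2⌋ ⌊ b /2⌋
  else if not (even a) ∧ not (even b) then Q ⌊ a /2⌋ ⌊ b /2⌋
  else false

IsKreweras : (n : ℕ) → NCP n → NCP n → Set
IsKreweras n P Q =
  NonCrossing (n + n) (proj₁ P ∪ᵖ proj₁ Q) ×
  ((Q′ : NCP n) → NonCrossing (n + n) (proj₁ P ∪ᵖ proj₁ Q′) →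
     Refines n (proj₁ Q′) (proj₁ Q))

-- Write S τ = φ (R τ), a partition of [2n] where n = size τ. Since R (σ ∨ τ) = (| ∨ R σ) ∨ R τ,
-- S (σ ∨ τ) = (| \underline* S σ) * (| \underline* S τ), and by induction on τ, S τ is a
-- noncrossing partition each of whose blocks lies among the odd or among the even points, and
-- which is Kreweras-closed: two points of equal parity lie in one block unless some block of the
-- other parity separates them. Write S τ = P ∪ Q. If P ∪ Q′ is noncrossing and Q′ joins two
-- points, no block of P separates them (it would cross in P ∪ Q′), so by closedness Q joins them
-- too; hence Q = K(P). Conversely, the P-part of S (σ ∨ τ) is (| \underline* Q-part of S σ) *
-- (P-part of S τ) and its Q-part is (P-part of S σ) * (| \underline* Q-part of S τ). Cutting a
-- noncrossing partition after the block of its first point, or before the block of its last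
-- point, shows by a simultaneous induction that both parts range over all of NCP_n.

{-# OPTIONS --safe #-}
module Submission where

open import Defs
open import Data.Nat using (ℕ; zero; suc; _+_; _∸_; _<_; _≤_; _<ᵇ_; ⌊_/2⌋; z≤n; s≤s; z<s; s<s)
open import Data.Nat.Properties
open import Data.Nat.Induction using (<-rec)
open import Data.Bool using (Bool; true; false; _∧_; _∨_; not)
open import Data.Bool.Properties
  using (not-involutive; not-injective; not-¬; ¬-not; ∧-identityʳ; ⇔→≡) renaming (_≟_ to _≟ᴮ_)
open import Data.Product using (Σ; _×_; ∃-syntax; _,_; proj₁; proj₂)
open import Data.Sum as Sum using (_⊎_; inj₁; inj₂)
open import Data.Empty using (⊥; ⊥-elim)
open import Function using (_∘_)
open import Function.Bundles using (mk⇔)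
open import Relation.Binary.PropositionalEquality
open import Relation.Binary.Definitions using (tri<; tri≈; tri>)
open import Relation.Nullary using (¬_; yes; no)

open IsPartition

double : ℕ → ℕ
double zero    = zero
double (suc h) = suc (suc (double h))

double≡+ : ∀ h → double h ≡ h + h
double≡+ zero    = refl
double≡+ (suc h) = cong suc (trans (cong suc (double≡+ h)) (sym (+-suc h h)))

double-+ : ∀ m k → double (m + k) ≡ double m + double k
double-+ zero    k = refl
double-+ (suc m) k = cong (λ z → suc (suc z)) (double-+ m k)

double-suc-+ : ∀ m k → double (suc (m + k)) ≡ suc (double m) + suc (double k)
double-suc-+ m k = cong suc (begin
  suc (double (m + k))        ≡⟨ cong suc (double-+ m k) ⟩
  suc (double m + double k)   ≡⟨ +-suc (double m) (double k) ⟨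
  double m + suc (double k)   ∎)
  where open ≡-Reasoning

even-double : ∀ h → even (double h) ≡ true
even-double zero    = refl
even-double (suc h) = trans (not-involutive _) (even-double h)

even-suc-double : ∀ h → even (suc (double h)) ≡ false
even-suc-double h = cong not (even-double h)

even-+-cong : ∀ M {a b} → even a ≡ even b → even (M + a) ≡ even (M + b)
even-+-cong zero    e = e
even-+-cong (suc M) e = cong not (even-+-cong M e)

even-+-cancel : ∀ M {a b} → even (M + a) ≡ even (M + b) → even a ≡ even b
even-+-cancel zero    e = e
even-+-cancel (suc M) e = even-+-cancel M (not-injective e)

even≢even-suc : ∀ n → even n ≢ even (suc n)
even≢even-suc n = not-¬ refl

⌊double/2⌋≡ : ∀ h → ⌊ double h /2⌋ ≡ h
⌊double/2⌋≡ zero    = refl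
⌊double/2⌋≡ (suc h) = cong suc (⌊double/2⌋≡ h)

⌊suc-double/2⌋≡ : ∀ h → ⌊ suc (double h) /2⌋ ≡ h
⌊suc-double/2⌋≡ zero    = refl
⌊suc-double/2⌋≡ (suc h) = cong suc (⌊suc-double/2⌋≡ h)

data Half : ℕ → Set where
  twice   : ∀ h → Half (double h)
  twice+1 : ∀ h → Half (suc (double h))

half : ∀ a → Half a
half zero = twice zero
half (suc a) with half a
... | twice h   = twice+1 h
... | twice+1 h = twice (suc h)

double-mono-≤ : ∀ {a b} → a ≤ b → double a ≤ double b
double-mono-≤ z≤n     = z≤n
double-mono-≤ (s≤s p) = s≤s (s≤s (double-mono-≤ p))

double-mono-< : ∀ {a b} → a < b → double a < double b
double-mono-< (s≤s p) = s≤s (m≤n⇒m≤1+n (double-mono-≤ p))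

<⇒suc-double<double : ∀ {a b} → a < b → suc (double a) < double b
<⇒suc-double<double (s≤s p) = s≤s (s≤s (double-mono-≤ p))

double-cancel-< : ∀ {a b} → double a < double b → a < b
double-cancel-< {zero}  {suc b} _             = z<s
double-cancel-< {suc a} {suc b} (s≤s (s≤s p)) = s≤s (double-cancel-< p)

EqOn-refl : ∀ {N r} → EqOn N r r
EqOn-refl _ _ _ _ = refl

EqOn-sym : ∀ {N r s} → EqOn N r s → EqOn N s r
EqOn-sym e a b p q = sym (e a b p q)

EqOn-trans : ∀ {N r s t} → EqOn N r s → EqOn N s t → EqOn N r t
EqOn-trans e f a b p q = trans (e a b p q) (f a b p q)

EqOn-subst : ∀ {N N′ r s} → N ≡ N′ → EqOn N r s → EqOn N′ r s
EqOn-subst refl e = e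

NonCrossing-resp-EqOn : ∀ {N r s} → EqOn N r s → NonCrossing N r → NonCrossing N s
NonCrossing-resp-EqOn {N} e nc a b c d a<b b<c c<d d<N rac rbd =
  trans (sym (e a b a<N b<N))
        (nc a b c d a<b b<c c<d d<N (trans (e a c a<N c<N) rac) (trans (e b d b<N d<N) rbd))
  where
  c<N : c < N
  c<N = <-trans c<d d<N
  b<N : b < N
  b<N = <-trans b<c c<N
  a<N : a < N
  a<N = <-trans a<b b<N

module _ {N : ℕ} {r : Rel₂} (isr : IsPartition N r) where

  sameBlock-comm : ∀ {x y} → x < N → y < N → r x y ≡ r y x
  sameBlock-comm x<N y<N =
    ⇔→≡ (mk⇔ (isr .sym′ _ _ x<N y<N) (isr .sym′ _ _ y<N x<N))

  sameBlock-resp : ∀ {x y z} → x < N → y < N → z < N → r x y ≡ true → r z x ≡ r z y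
  sameBlock-resp x<N y<N z<N rxy =
    ⇔→≡ (mk⇔ (λ rzx → isr .trans′ _ _ _ z<N x<N y<N rzx rxy)
              (λ rzy → isr .trans′ _ _ _ z<N y<N x<N rzy (isr .sym′ _ _ x<N y<N rxy)))

reindex : (ℕ → ℕ) → Rel₂ → Rel₂
reindex f r a b = r (f a) (f b)

shift : ℕ → Rel₂ → Rel₂
shift s = reindex (s +_)

module _ {N L : ℕ} {r : Rel₂} (f : ℕ → ℕ) (f< : ∀ {a} → a < L → f a < N) where

  reindex-isPartition : IsPartition N r → IsPartition L (reindex f r)
  reindex-isPartition isr = record
    { refl′  = λ a p → isr .refl′ _ (f< p)
    ; sym′   = λ a b p q → isr .sym′ _ _ (f< p) (f< q)
    ; trans′ = λ a b c p q t → isr .trans′ _ _ _ (f< p) (f< q) (f< t)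
    }

  reindex-noncrossing : (∀ {a b} → a < b → f a < f b) →
    NonCrossing N r → NonCrossing L (reindex f r)
  reindex-noncrossing f-mono nc a b c d a<b b<c c<d d<L =
    nc _ _ _ _ (f-mono a<b) (f-mono b<c) (f-mono c<d) (f< d<L)

module _ {N : ℕ} {r : Rel₂} (s L : ℕ) (s+L≤N : s + L ≤ N) where

  private
    shift< : ∀ {a} → a < L → s + a < N
    shift< a<L = <-≤-trans (+-monoʳ-< s a<L) s+L≤N

  shift-isPartition : IsPartition N r → IsPartition L (shift s r)
  shift-isPartition = reindex-isPartition (s +_) shift<

  shift-noncrossing : NonCrossing N r → NonCrossing L (shift s r)
  shift-noncrossing = reindex-noncrossing (s +_) shift< (+-monoʳ-< s)

shiftNCP : ∀ {N} s L → s + L ≤ N → NCP N → NCP L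
shiftNCP s L s+L≤N (r , isr , ncr) =
  shift s r , shift-isPartition s L s+L≤N isr , shift-noncrossing s L s+L≤N ncr

-- Kreweras-closed partitions

ParityRespecting : ℕ → Rel₂ → Set
ParityRespecting N S = ∀ a b → a < N → b < N → S a b ≡ true → even a ≡ even b

-- u and v can be joined by an arc that crosses no block of the other parity.
Unobstructed : ℕ → Rel₂ → ℕ → ℕ → Set
Unobstructed N S u v = ∀ x y → u < x → x < v → y < N → (y < u ⊎ v < y) →
  even x ≢ even u → S x y ≡ true → ⊥

KrewerasClosed : ℕ → Rel₂ → Set
KrewerasClosed N S = ∀ u v → u < v → v < N → even u ≡ even v →
  Unobstructed N S u v → S u v ≡ true

record IsKrewerasUnion (N : ℕ) (S : Rel₂) : Set where
  field
    isPartition      : IsPartition N S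
    noncrossing      : NonCrossing N S
    parityRespecting : ParityRespecting N S
    krewerasClosed   : KrewerasClosed N S

open IsKrewerasUnion

<⇒<ᵇ≡true : ∀ {a M} → a < M → (a <ᵇ M) ≡ true
<⇒<ᵇ≡true {zero}  {suc M} _       = refl
<⇒<ᵇ≡true {suc a} {suc M} (s≤s p) = <⇒<ᵇ≡true p

+<ᵇ≡false : ∀ M a → (M + a <ᵇ M) ≡ false
+<ᵇ≡false zero    a = refl
+<ᵇ≡false (suc M) a = +<ᵇ≡false M a

data Side (M : ℕ) : ℕ → Set where
  left  : ∀ {a} → a < M → Side M a
  right : ∀ a → Side M (M + a)

side : ∀ M a → Side M a
side zero    a       = right a
side (suc M) zero    = left z<s
side (suc M) (suc a) with side M a
... | left p  = left (s<s p)
... | right b = right b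

module _ (M : ℕ) (A B : Rel₂) where

  concat-left : ∀ {a b} → a < M → b < M → concat M A B a b ≡ A a b
  concat-left p q rewrite <⇒<ᵇ≡true p | <⇒<ᵇ≡true q = refl

  concat-right : ∀ a b → concat M A B (M + a) (M + b) ≡ B a b
  concat-right a b
    rewrite +<ᵇ≡false M a | +<ᵇ≡false M b | m+n∸m≡n M a | m+n∸m≡n M b = refl

  concat-left-right : ∀ {a} b → a < M → concat M A B a (M + b) ≡ false
  concat-left-right b p rewrite <⇒<ᵇ≡true p | +<ᵇ≡false M b = refl

  concat-right-left : ∀ a {b} → b < M → concat M A B (M + a) b ≡ false
  concat-right-left a q rewrite <⇒<ᵇ≡true q | +<ᵇ≡false M a = refl

concat-cong : ∀ M K {A A′ B B′} → EqOn M A A′ → EqOn K B B′ →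
  EqOn (M + K) (concat M A B) (concat M A′ B′)
concat-cong M K {A} {A′} {B} {B′} eA eB a b a<N b<N with side M a | side M b
... | left p   | left q   =
  trans (concat-left M A B p q) (trans (eA a b p q) (sym (concat-left M A′ B′ p q)))
... | left p   | right b′ =
  trans (concat-left-right M A B b′ p) (sym (concat-left-right M A′ B′ b′ p))
... | right a′ | left q   =
  trans (concat-right-left M A B a′ q) (sym (concat-right-left M A′ B′ a′ q))
... | right a′ | right b′ =
  trans (concat-right M A B a′ b′)
        (trans (eB a′ b′ (+-cancelˡ-< M _ _ a<N) (+-cancelˡ-< M _ _ b<N))
               (sym (concat-right M A′ B′ a′ b′)))

concat-reindex : ∀ {M M′} (f g : ℕ → ℕ) (A B : Rel₂) →
  (∀ {a} → a < M′ → f a < M) → (∀ a → f (M′ + a) ≡ M + g a) →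
  ∀ {N} → EqOn N (reindex f (concat M A B)) (concat M′ (reindex f A) (reindex g B))
concat-reindex {M} {M′} f g A B f< f+ a b _ _ with side M′ a | side M′ b
... | left p   | left q   =
  trans (concat-left M A B (f< p) (f< q))
        (sym (concat-left M′ (reindex f A) (reindex g B) p q))
... | left p   | right b′ =
  trans (cong (concat M A B (f a)) (f+ b′))
        (trans (concat-left-right M A B (g b′) (f< p))
               (sym (concat-left-right M′ (reindex f A) (reindex g B) b′ p)))
... | right a′ | left q   =
  trans (cong (λ z → concat M A B z (f b)) (f+ a′))
        (trans (concat-right-left M A B (g a′) (f< q))
               (sym (concat-right-left M′ (reindex f A) (reindex g B) a′ q)))
... | right a′ | right b′ =
  trans (cong₂ (concat M A B) (f+ a′) (f+ b′))
        (trans (concat-right M A B (g a′) (g b′))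
               (sym (concat-right M′ (reindex f A) (reindex g B) a′ b′)))

concat-split : ∀ {N r} m → IsPartition N r →
  (∀ {a} b → a < m → m + b < N → r a (m + b) ≡ false) →
  EqOn N r (concat m r (shift m r))
concat-split {r = r} m isr cut a b a<N b<N with side m a | side m b
... | left p   | left q   = sym (concat-left m r (shift m r) p q)
... | left p   | right b′ = trans (cut b′ p b<N) (sym (concat-left-right m r (shift m r) b′ p))
... | right a′ | left q   =
  trans (sameBlock-comm isr a<N b<N)
        (trans (cut a′ q a<N) (sym (concat-right-left m r (shift m r) a′ q)))
... | right a′ | right b′ = sym (concat-right m r (shift m r) a′ b′)

-- If u has the parity of M, the block of A through 0 and M ∸ 1 separates u from M + v′;
-- otherwise the block of B through M and M + K ∸ 1 does.
concat-straddle-obstructed : ∀ {M K A B} → IsKrewerasUnion M A → IsKrewerasUnion K B →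
  A 0 (M ∸ 1) ≡ true → B 0 (K ∸ 1) ≡ true →
  ∀ {u} v′ → u < M → v′ < K → even u ≡ even (M + v′) →
  ¬ Unobstructed (M + K) (concat M A B) u (M + v′)
concat-straddle-obstructed {suc M₀} {suc K₀} {A} {B} KA KB a0 b0 {u} v′ u<M v′<K u~v unob
  with even u ≟ᴮ even (suc M₀)
... | yes u~M =
  unob M₀ 0 u<M₀ (s≤s (m≤m+n M₀ v′)) z<s (inj₁ 0<u) (λ M₀~u → even≢even-suc M₀ (trans M₀~u u~M))
       (trans (concat-left (suc M₀) A B ≤-refl z<s) (isPartition KA .sym′ 0 M₀ z<s ≤-refl a0))
  where
  u<M₀ : u < M₀
  u<M₀ = ≤∧≢⇒< (≤-pred u<M) (λ u≡M₀ → even≢even-suc M₀ (trans (cong even (sym u≡M₀)) u~M))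
  0<u : 0 < u
  0<u = n≢0⇒n>0 λ { refl →
    even≢even-suc M₀ (trans (sym (parityRespecting KA 0 M₀ z<s ≤-refl a0)) u~M) }
... | no u≁M =
  unob (M + 0) (M + K₀) (<-≤-trans u<M (m≤m+n M 0)) (+-monoʳ-< M 0<v′) (+-monoʳ-< M ≤-refl)
       (inj₂ (+-monoʳ-< M v′<K₀)) (λ M~u → u≁M (sym (trans (sym M+0~M) M~u)))
       (trans (concat-right M A B 0 K₀) b0)
  where
  M : ℕ
  M = suc M₀
  M+0~M : even (M + 0) ≡ even M
  M+0~M = cong even (+-identityʳ M)
  0<v′ : 0 < v′
  0<v′ = n≢0⇒n>0 λ { refl → u≁M (trans u~v M+0~M) }
  v′<K₀ : v′ < K₀
  v′<K₀ = ≤∧≢⇒< (≤-pred v′<K) λ { refl →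
    u≁M (trans u~v (trans (even-+-cong M (sym (parityRespecting KB 0 K₀ z<s ≤-refl b0))) M+0~M)) }

module _ {M K : ℕ} {A B : Rel₂} where

  private
    S : Rel₂
    S = concat M A B

    A⁺ : ∀ {a b} → a < M → b < M → A a b ≡ true → S a b ≡ true
    A⁺ p q h = trans (concat-left M A B p q) h

    A⁻ : ∀ {a b} → a < M → b < M → S a b ≡ true → A a b ≡ true
    A⁻ p q h = trans (sym (concat-left M A B p q)) h

    B⁺ : ∀ {a b} → B a b ≡ true → S (M + a) (M + b) ≡ true
    B⁺ h = trans (concat-right M A B _ _) h

    B⁻ : ∀ {a b} → S (M + a) (M + b) ≡ true → B a b ≡ true
    B⁻ h = trans (sym (concat-right M A B _ _)) h

    left-right-⊥ : ∀ {a} b → a < M → S a (M + b) ≡ true → ⊥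
    left-right-⊥ b p h = not-¬ h (concat-left-right M A B b p)

    right-left-⊥ : ∀ a {b} → b < M → S (M + a) b ≡ true → ⊥
    right-left-⊥ a q h = not-¬ h (concat-right-left M A B a q)

    cancel : ∀ {a b} → M + a < M + b → a < b
    cancel = +-cancelˡ-< M _ _

    right-not-below-left : ∀ {a b} → M + a < b → b < M → ⊥
    right-not-below-left {a} p q = <-irrefl refl (≤-<-trans (m≤m+n M a) (<-trans p q))

  concat-isPartition : IsPartition M A → IsPartition K B → IsPartition (M + K) (concat M A B)
  concat-isPartition isA isB .refl′ a a<N with side M a
  ... | left p   = A⁺ p p (isA .refl′ a p)
  ... | right a′ = B⁺ (isB .refl′ a′ (cancel a<N))
  concat-isPartition isA isB .sym′ a b a<N b<N h with side M a | side M b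
  ... | left p   | left q   = A⁺ q p (isA .sym′ a b p q (A⁻ p q h))
  ... | left p   | right b′ = ⊥-elim (left-right-⊥ b′ p h)
  ... | right a′ | left q   = ⊥-elim (right-left-⊥ a′ q h)
  ... | right a′ | right b′ = B⁺ (isB .sym′ a′ b′ (cancel a<N) (cancel b<N) (B⁻ h))
  concat-isPartition isA isB .trans′ a b c a<N b<N c<N h₁ h₂
    with side M a | side M b | side M c
  ... | left p   | left q   | left t   = A⁺ p t (isA .trans′ a b c p q t (A⁻ p q h₁) (A⁻ q t h₂))
  ... | left p   | right b′ | _        = ⊥-elim (left-right-⊥ b′ p h₁)
  ... | right a′ | left q   | _        = ⊥-elim (right-left-⊥ a′ q h₁)
  ... | left p   | left q   | right c′ = ⊥-elim (left-right-⊥ c′ q h₂)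
  ... | right a′ | right b′ | left t   = ⊥-elim (right-left-⊥ b′ t h₂)
  ... | right a′ | right b′ | right c′ =
    B⁺ (isB .trans′ a′ b′ c′ (cancel a<N) (cancel b<N) (cancel c<N) (B⁻ h₁) (B⁻ h₂))

  concat-noncrossing : NonCrossing M A → NonCrossing K B → NonCrossing (M + K) (concat M A B)
  concat-noncrossing ncA ncB a b c d a<b b<c c<d d<N h₁ h₂ with side M c
  ... | left t with side M d
  ...   | left s   = let q = <-trans b<c t ; p = <-trans a<b q in
                     A⁺ p q (ncA a b c d a<b b<c c<d s (A⁻ p t h₁) (A⁻ q s h₂))
  ...   | right d′ = ⊥-elim (left-right-⊥ d′ (<-trans b<c t) h₂)
  concat-noncrossing ncA ncB a b c d a<b b<c c<d d<N h₁ h₂ | right c′ with side M a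
  ... | left p = ⊥-elim (left-right-⊥ c′ p h₁)
  ... | right a′ with side M b
  ...   | left q = ⊥-elim (right-not-below-left a<b q)
  ...   | right b′ with side M d
  ...     | left s   = ⊥-elim (right-not-below-left c<d s)
  ...     | right d′ =
    B⁺ (ncB a′ b′ c′ d′ (cancel a<b) (cancel b<c) (cancel c<d) (cancel d<N) (B⁻ h₁) (B⁻ h₂))

  concat-parityRespecting : ParityRespecting M A → ParityRespecting K B →
    ParityRespecting (M + K) (concat M A B)
  concat-parityRespecting prA prB a b a<N b<N h with side M a | side M b
  ... | left p   | left q   = prA a b p q (A⁻ p q h)
  ... | left p   | right b′ = ⊥-elim (left-right-⊥ b′ p h)
  ... | right a′ | left q   = ⊥-elim (right-left-⊥ a′ q h)
  ... | right a′ | right b′ = even-+-cong M (prB a′ b′ (cancel a<N) (cancel b<N) (B⁻ h))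

  concat-krewerasClosed : IsKrewerasUnion M A → IsKrewerasUnion K B →
    A 0 (M ∸ 1) ≡ true → B 0 (K ∸ 1) ≡ true → KrewerasClosed (M + K) (concat M A B)
  concat-krewerasClosed KA KB a0 b0 u v u<v v<N u~v unob with side M u | side M v
  ... | left p   | left q   = A⁺ p q (krewerasClosed KA u v u<v q u~v unobA)
    where
    unobA : Unobstructed M A u v
    unobA x y u<x x<v y<M out x≁u h =
      unob x y u<x x<v (<-≤-trans y<M (m≤m+n M K)) out x≁u (A⁺ (<-trans x<v q) y<M h)
  ... | right u′ | left q   = ⊥-elim (right-not-below-left u<v q)
  ... | left p   | right v′ =
    ⊥-elim (concat-straddle-obstructed KA KB a0 b0 v′ p (cancel v<N) u~v unob)
  ... | right u′ | right v′ =
    B⁺ (krewerasClosed KB u′ v′ (cancel u<v) (cancel v<N) (even-+-cancel M u~v) unobB)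
    where
    unobB : Unobstructed K B u′ v′
    unobB x y u<x x<v y<K out x≁u h =
      unob (M + x) (M + y) (+-monoʳ-< M u<x) (+-monoʳ-< M x<v) (+-monoʳ-< M y<K)
           (Sum.map (+-monoʳ-< M) (+-monoʳ-< M) out) (x≁u ∘ even-+-cancel M) (B⁺ h)

  concat-isKrewerasUnion : IsKrewerasUnion M A → IsKrewerasUnion K B →
    A 0 (M ∸ 1) ≡ true → B 0 (K ∸ 1) ≡ true → IsKrewerasUnion (M + K) (concat M A B)
  concat-isKrewerasUnion KA KB a0 b0 = record
    { isPartition      = concat-isPartition (isPartition KA) (isPartition KB)
    ; noncrossing      = concat-noncrossing (noncrossing KA) (noncrossing KB)
    ; parityRespecting = concat-parityRespecting (parityRespecting KA) (parityRespecting KB)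
    ; krewerasClosed   = concat-krewerasClosed KA KB a0 b0
    }

-- The paper's | \underline* X for X a partition of [L]: a new first point joins the block of the
-- last point L ∸ 1 of X.
prependToLast : ℕ → Rel₂ → Rel₂
prependToLast L X zero    zero    = true
prependToLast L X zero    (suc b) = X b (L ∸ 1)
prependToLast L X (suc a) zero    = X a (L ∸ 1)
prependToLast L X (suc a) (suc b) = X a b

prependToLast-cong : ∀ L {X X′} → EqOn L X X′ →
  EqOn (suc L) (prependToLast L X) (prependToLast L X′)
prependToLast-cong L       e zero    zero    _       _       = refl
prependToLast-cong (suc L) e zero    (suc b) _       (s≤s q) = e b L q ≤-refl
prependToLast-cong (suc L) e (suc a) zero    (s≤s p) _       = e a L p ≤-refl
prependToLast-cong L       e (suc a) (suc b) (s≤s p) (s≤s q) = e a b p q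

∨-absorbs-∧ : ∀ p q r → (q ≡ true → r ≡ true → p ≡ true) → p ∨ (q ∧ r) ≡ p
∨-absorbs-∧ true  q     r     _ = refl
∨-absorbs-∧ false false r     _ = refl
∨-absorbs-∧ false true  false _ = refl
∨-absorbs-∧ false true  true  f = sym (f refl refl)

merge-∣ᵖ≈prependToLast : ∀ L {X X′} → IsPartition L X′ → EqOn L X X′ →
  EqOn (suc L) (merge 1 L ∣ᵖ X) (prependToLast L X′)
merge-∣ᵖ≈prependToLast zero    isX e zero    zero    _       _       = refl
merge-∣ᵖ≈prependToLast zero    isX e zero    (suc b) _       (s≤s ())
merge-∣ᵖ≈prependToLast zero    isX e (suc a) _       (s≤s ()) _
merge-∣ᵖ≈prependToLast (suc L) isX e zero    zero    _       _       = refl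
merge-∣ᵖ≈prependToLast (suc L) isX e zero    (suc b) _       (s≤s q) = e b L q ≤-refl
merge-∣ᵖ≈prependToLast (suc L) isX e (suc a) zero    (s≤s p) _       =
  trans (∧-identityʳ _) (e a L p ≤-refl)
merge-∣ᵖ≈prependToLast (suc L) {X} {X′} isX e (suc a) (suc b) (s≤s p) (s≤s q)
  rewrite e a b p q | e a L p ≤-refl | e b L q ≤-refl =
  ∨-absorbs-∧ (X′ a b) (X′ a L) (X′ b L)
    (λ raL rbL → isX .trans′ a L b p ≤-refl q raL (isX .sym′ b L q ≤-refl rbL))

prependToLast-0-last : ∀ L {X} → IsPartition L X → prependToLast L X 0 L ≡ true
prependToLast-0-last zero    isX = refl
prependToLast-0-last (suc L) isX = isX .refl′ L ≤-refl

prependToLast-shift : ∀ L {r} → IsPartition (suc L) r → r 0 L ≡ true →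
  EqOn (suc L) (prependToLast L (shift 1 r)) r
prependToLast-shift L       isr r0L zero    zero    _ _   = sym (isr .refl′ 0 z<s)
prependToLast-shift (suc L) isr r0L zero    (suc b) _ b<N =
  trans (sym (sameBlock-resp isr z<s ≤-refl b<N r0L)) (sameBlock-comm isr b<N z<s)
prependToLast-shift zero    isr r0L zero    (suc b) _ (s≤s ())
prependToLast-shift zero    isr r0L (suc a) zero    (s≤s ()) _
prependToLast-shift (suc L) isr r0L (suc a) zero    a<N _ =
  sym (sameBlock-resp isr z<s ≤-refl a<N r0L)
prependToLast-shift L       isr r0L (suc a) (suc b) _ _   = refl

∸1< : ∀ {b L} → b < L → L ∸ 1 < L
∸1< {L = suc L} _ = ≤-refl

prependToLast-isPartition : ∀ L {X} → IsPartition L X → IsPartition (suc L) (prependToLast L X)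
prependToLast-isPartition L {X} isX =
  record { refl′ = reflexive ; sym′ = symmetric ; trans′ = transitive }
  where
  reflexive : ∀ a → a < suc L → prependToLast L X a a ≡ true
  reflexive zero    _       = refl
  reflexive (suc a) (s≤s p) = isX .refl′ a p
  symmetric : ∀ a b → a < suc L → b < suc L →
    prependToLast L X a b ≡ true → prependToLast L X b a ≡ true
  symmetric zero    zero    _       _       h = h
  symmetric zero    (suc b) _       _       h = h
  symmetric (suc a) zero    _       _       h = h
  symmetric (suc a) (suc b) (s≤s p) (s≤s q) h = isX .sym′ a b p q h
  transitive : ∀ a b c → a < suc L → b < suc L → c < suc L →
    prependToLast L X a b ≡ true → prependToLast L X b c ≡ true → prependToLast L X a c ≡ true
  transitive zero    zero    c       _       _       _       h₁ h₂ = h₂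
  transitive zero    (suc b) zero    _       _       _       h₁ h₂ = refl
  transitive zero    (suc b) (suc c) _       (s≤s q) (s≤s t) h₁ h₂ =
    isX .trans′ c b _ t q (∸1< q) (isX .sym′ b c q t h₂) h₁
  transitive (suc a) zero    zero    _       _       _       h₁ h₂ = h₁
  transitive (suc a) zero    (suc c) (s≤s p) _       (s≤s t) h₁ h₂ =
    isX .trans′ a _ c p (∸1< p) t h₁ (isX .sym′ c _ t (∸1< p) h₂)
  transitive (suc a) (suc b) zero    (s≤s p) (s≤s q) _       h₁ h₂ =
    isX .trans′ a b _ p q (∸1< p) h₁ h₂
  transitive (suc a) (suc b) (suc c) (s≤s p) (s≤s q) (s≤s t) h₁ h₂ = isX .trans′ a b c p q t h₁ h₂

prependToLast-noncrossing : ∀ L {X} → IsPartition L X → NonCrossing L X →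
  NonCrossing (suc L) (prependToLast L X)
prependToLast-noncrossing L isX ncX (suc a) (suc b) (suc c) (suc d)
  (s≤s a<b) (s≤s b<c) (s≤s c<d) (s≤s d<L) h₁ h₂ = ncX a b c d a<b b<c c<d d<L h₁ h₂
prependToLast-noncrossing (suc ℓ) isX ncX zero (suc b) (suc c) (suc d)
  _ (s≤s b<c) (s≤s c<d) (s≤s d<L) h₁ h₂ with m<1+n⇒m<n∨m≡n d<L
... | inj₂ refl = h₂
... | inj₁ d<ℓ  =
  isX .trans′ b c ℓ b<L c<L ≤-refl (ncX b c d ℓ b<c c<d d<ℓ ≤-refl h₂ h₁) h₁
  where
  c<L : c < suc ℓ
  c<L = <-trans c<d d<L
  b<L : b < suc ℓ
  b<L = <-trans b<c c<L

prependToLast-parityRespecting : ∀ L {X} → even L ≡ true → ParityRespecting L X →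
  ParityRespecting (suc L) (prependToLast L X)
prependToLast-parityRespecting L       eL prX zero    zero    _       _       _ = refl
prependToLast-parityRespecting (suc ℓ) eL prX zero    (suc b) _       (s≤s q) h =
  sym (trans (cong not (prX b ℓ q ≤-refl h)) eL)
prependToLast-parityRespecting (suc ℓ) eL prX (suc a) zero    (s≤s p) _       h =
  trans (cong not (prX a ℓ p ≤-refl h)) eL
prependToLast-parityRespecting L       eL prX (suc a) (suc b) (s≤s p) (s≤s q) h =
  cong not (prX a b p q h)

prependToLast-krewerasClosed : ∀ L {X} → even L ≡ true → IsKrewerasUnion L X →
  KrewerasClosed (suc L) (prependToLast L X)
prependToLast-krewerasClosed L {X} eL KX (suc u) (suc v) (s≤s u<v) (s≤s v<L) u~v unob =
  krewerasClosed KX u v u<v v<L (not-injective u~v) unobX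
  where
  unobX : Unobstructed L X u v
  unobX x y u<x x<v y<L out x≁u h =
    unob (suc x) (suc y) (s≤s u<x) (s≤s x<v) (s≤s y<L) (Sum.map s≤s s≤s out)
         (x≁u ∘ not-injective) h
prependToLast-krewerasClosed (suc ℓ) {X} eL KX zero (suc v) _ (s≤s v<L) 0~v unob
  with m<1+n⇒m<n∨m≡n v<L
... | inj₂ refl = isPartition KX .refl′ ℓ ≤-refl
... | inj₁ v<ℓ  = krewerasClosed KX v ℓ v<ℓ ≤-refl v~ℓ unobX
  where
  v~ℓ : even v ≡ even ℓ
  v~ℓ = not-injective (trans (sym 0~v) (sym eL))
  unobX : Unobstructed (suc ℓ) X v ℓ
  unobX x y v<x x<ℓ y<L (inj₂ ℓ<y) x≁v h = <-irrefl refl (<-≤-trans ℓ<y (≤-pred y<L))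
  unobX x y v<x x<ℓ y<L (inj₁ y<v) x≁v h =
    unob (suc y) (suc x) z<s (s≤s y<v) (s≤s x<L) (inj₂ (s≤s v<x))
         (λ y~0 → x≁v (trans (parityRespecting KX x y x<L y<L h) (not-injective (trans y~0 0~v))))
         (isPartition KX .sym′ x y x<L y<L h)
    where
    x<L : x < suc ℓ
    x<L = <-trans x<ℓ ≤-refl

prependToLast-isKrewerasUnion : ∀ L {X} → even L ≡ true → IsKrewerasUnion L X →
  IsKrewerasUnion (suc L) (prependToLast L X)
prependToLast-isKrewerasUnion L eL KX = record
  { isPartition      = prependToLast-isPartition L (isPartition KX)
  ; noncrossing      = prependToLast-noncrossing L (isPartition KX) (noncrossing KX)
  ; parityRespecting = prependToLast-parityRespecting L eL (parityRespecting KX)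
  ; krewerasClosed   = prependToLast-krewerasClosed L eL KX
  }

-- φ ∘ R

ψ : Tree → Rel₂
ψ leaf     = ∅ᵖ
ψ (σ ∨ᵗ τ) = concat (suc (double (size σ)))
                    (prependToLast (double (size σ)) (ψ σ))
                    (prependToLast (double (size τ)) (ψ τ))

∅ᵖ-isKrewerasUnion : IsKrewerasUnion 0 ∅ᵖ
∅ᵖ-isKrewerasUnion = record
  { isPartition      = record { refl′ = λ _ () ; sym′ = λ _ _ () ; trans′ = λ _ _ _ () }
  ; noncrossing      = λ _ _ _ _ _ _ _ ()
  ; parityRespecting = λ _ _ ()
  ; krewerasClosed   = λ _ _ _ ()
  }

ψ-isKrewerasUnion : ∀ τ → IsKrewerasUnion (double (size τ)) (ψ τ)
ψ-isKrewerasUnion leaf     = ∅ᵖ-isKrewerasUnion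
ψ-isKrewerasUnion (σ ∨ᵗ τ) =
  subst (λ N → IsKrewerasUnion N (ψ (σ ∨ᵗ τ))) (sym (double-suc-+ (size σ) (size τ)))
    (concat-isKrewerasUnion (prepended σ) (prepended τ)
      (prependToLast-0-last _ (isPartition (ψ-isKrewerasUnion σ)))
      (prependToLast-0-last _ (isPartition (ψ-isKrewerasUnion τ))))
  where
  prepended : ∀ υ → IsKrewerasUnion (suc (double (size υ))) (prependToLast (double (size υ)) (ψ υ))
  prepended υ = prependToLast-isKrewerasUnion _ (even-double (size υ)) (ψ-isKrewerasUnion υ)

size-R : ∀ τ → size (R τ) ≡ double (size τ)
size-R leaf     = refl
size-R (σ ∨ᵗ τ) = cong (λ z → suc (suc z))
  (trans (cong₂ _+_ (size-R σ) (size-R τ)) (sym (double-+ (size σ) (size τ))))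

φ∘R≈ψ : ∀ τ → EqOn (double (size τ)) (φ (R τ)) (ψ τ)
φ∘R≈ψ leaf     _ _ ()
φ∘R≈ψ (σ ∨ᵗ τ) = EqOn-subst (sym (double-suc-+ (size σ) (size τ))) (unfold (size-R σ) (size-R τ))
  where
  -- Generalising size (R σ) and size (R τ) lets size-R be matched away; φ (| ∨ ρ) is
  -- concat 0 ∅ᵖ X, which reduces to X.
  unfold : ∀ {Lσ Lτ} → Lσ ≡ double (size σ) → Lτ ≡ double (size τ) →
    EqOn (suc (double (size σ)) + suc (double (size τ)))
         (concat (suc Lσ) (merge 1 Lσ ∣ᵖ (φ (R σ))) (merge 1 Lτ ∣ᵖ (φ (R τ))))
         (ψ (σ ∨ᵗ τ))
  unfold refl refl = concat-cong _ _
    (merge-∣ᵖ≈prependToLast _ (isPartition (ψ-isKrewerasUnion σ)) (φ∘R≈ψ σ))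
    (merge-∣ᵖ≈prependToLast _ (isPartition (ψ-isKrewerasUnion τ)) (φ∘R≈ψ τ))

module _ (P Q : Rel₂) where

  ∪ᵖ-even-even : ∀ x y → (P ∪ᵖ Q) (double x) (double y) ≡ P x y
  ∪ᵖ-even-even x y
    rewrite even-double x | even-double y | ⌊double/2⌋≡ x | ⌊double/2⌋≡ y = refl

  ∪ᵖ-odd-odd : ∀ x y → (P ∪ᵖ Q) (suc (double x)) (suc (double y)) ≡ Q x y
  ∪ᵖ-odd-odd x y
    rewrite even-suc-double x | even-suc-double y | ⌊suc-double/2⌋≡ x | ⌊suc-double/2⌋≡ y = refl

  ∪ᵖ-even-odd : ∀ x y → (P ∪ᵖ Q) (double x) (suc (double y)) ≡ false
  ∪ᵖ-even-odd x y rewrite even-double x | even-suc-double y = refl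

  ∪ᵖ-odd-even : ∀ x y → (P ∪ᵖ Q) (suc (double x)) (double y) ≡ false
  ∪ᵖ-odd-even x y rewrite even-suc-double x | even-double y = refl

-- With points numbered from 0, evenPart S is the paper's P (on the points 2i - 1) and
-- oddPart S is its Q.
evenPart oddPart : Rel₂ → Rel₂
evenPart = reindex double
oddPart  = reindex (suc ∘ double)

module _ {n : ℕ} {S : Rel₂} (K : IsKrewerasUnion (double n) S) where

  evenPartNCP : NCP n
  evenPartNCP = evenPart S
              , reindex-isPartition double double-mono-< (isPartition K)
              , reindex-noncrossing double double-mono-< double-mono-< (noncrossing K)

  oddPartNCP : NCP n
  oddPartNCP = oddPart S
             , reindex-isPartition (suc ∘ double) <⇒suc-double<double (isPartition K)
             , reindex-noncrossing (suc ∘ double) <⇒suc-double<double (s≤s ∘ double-mono-<)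
                 (noncrossing K)

  private
    even≁odd : ∀ {x y} → double x < double n → suc (double y) < double n →
      S (double x) (suc (double y)) ≡ true → ⊥
    even≁odd {x} {y} p q h =
      not-¬ (even-double x) (trans (parityRespecting K _ _ p q h) (even-suc-double y))

  ≈evenPart∪oddPart : EqOn (double n) S (evenPart S ∪ᵖ oddPart S)
  ≈evenPart∪oddPart a b a<N b<N with half a | half b
  ... | twice x   | twice y   = sym (∪ᵖ-even-even (evenPart S) (oddPart S) x y)
  ... | twice+1 x | twice+1 y = sym (∪ᵖ-odd-odd (evenPart S) (oddPart S) x y)
  ... | twice x   | twice+1 y =
    trans (¬-not (even≁odd a<N b<N)) (sym (∪ᵖ-even-odd (evenPart S) (oddPart S) x y))
  ... | twice+1 x | twice y   =
    trans (¬-not (λ h → even≁odd b<N a<N (isPartition K .sym′ _ _ a<N b<N h)))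
          (sym (∪ᵖ-odd-even (evenPart S) (oddPart S) x y))

  -- A block of P through a point strictly between 2i + 1 and 2j + 1 and a point outside would
  -- cross the arc of Q′ from 2i + 1 to 2j + 1 in P ∪ Q′.
  oddPart-maximal : ∀ Q′ → NonCrossing (double n) (evenPart S ∪ᵖ Q′) →
    ∀ {i j} → i < j → j < n → Q′ i j ≡ true → oddPart S i j ≡ true
  oddPart-maximal Q′ nc {i} {j} i<j j<n Q′ij =
    krewerasClosed K _ _ (s≤s (double-mono-< i<j)) v<N
      (trans (even-suc-double i) (sym (even-suc-double j))) unob
    where
    v<N : suc (double j) < double n
    v<N = <⇒suc-double<double j<n
    P∪Q′ : Rel₂
    P∪Q′ = evenPart S ∪ᵖ Q′
    uv : P∪Q′ (suc (double i)) (suc (double j)) ≡ true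
    uv = trans (∪ᵖ-odd-odd (evenPart S) Q′ i j) Q′ij
    unob : Unobstructed (double n) S (suc (double i)) (suc (double j))
    unob x y u<x x<v y<N out x≁u Sxy with half x | half y
    ... | twice+1 x′ | _         = x≁u (trans (even-suc-double x′) (sym (even-suc-double i)))
    ... | twice x′   | twice+1 y′ = even≁odd (<-trans x<v v<N) y<N Sxy
    ... | twice x′   | twice y′   with out
    ...   | inj₁ y<u = not-¬ (nc _ _ _ _ y<u u<x x<v v<N xy uv) (∪ᵖ-even-odd (evenPart S) Q′ y′ i)
      where
      xy : P∪Q′ (double y′) (double x′) ≡ true
      xy = trans (∪ᵖ-even-even (evenPart S) Q′ y′ x′)
                 (isPartition K .sym′ _ _ (<-trans x<v v<N) y<N Sxy)
    ...   | inj₂ v<y = not-¬ (nc _ _ _ _ u<x x<v v<y y<N uv xy) (∪ᵖ-odd-even (evenPart S) Q′ i x′)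
      where
      xy : P∪Q′ (double x′) (double y′) ≡ true
      xy = trans (∪ᵖ-even-even (evenPart S) Q′ x′ y′) Sxy

  oddPart-greatest : (Q′ : NCP n) → NonCrossing (double n) (evenPart S ∪ᵖ proj₁ Q′) →
    Refines n (proj₁ Q′) (oddPart S)
  oddPart-greatest (Q′ , isQ′ , _) nc i j i<n j<n Q′ij with <-cmp i j
  ... | tri< i<j _ _  = oddPart-maximal Q′ nc i<j j<n Q′ij
  ... | tri≈ _ refl _ = isPartition K .refl′ _ (<⇒suc-double<double i<n)
  ... | tri> _ _ j<i  =
    isPartition K .sym′ _ _ (<⇒suc-double<double j<n) (<⇒suc-double<double i<n)
      (oddPart-maximal Q′ nc j<i i<n (isQ′ .sym′ i j i<n j<n Q′ij))

  isKreweras : IsKreweras n evenPartNCP oddPartNCP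
  isKreweras = subst (λ N → NonCrossing N (evenPart S ∪ᵖ oddPart S)) (double≡+ n)
                 (NonCrossing-resp-EqOn ≈evenPart∪oddPart (noncrossing K))
             , λ Q′ nc → oddPart-greatest Q′
                 (subst (λ N → NonCrossing N (evenPart S ∪ᵖ proj₁ Q′)) (sym (double≡+ n)) nc)

∪ᵖ-congˡ : ∀ n {P P′} Q → EqOn n P P′ → EqOn (n + n) (P ∪ᵖ Q) (P′ ∪ᵖ Q)
∪ᵖ-congˡ n {P} {P′} Q e = EqOn-subst (double≡+ n) congOnDouble
  where
  congOnDouble : EqOn (double n) (P ∪ᵖ Q) (P′ ∪ᵖ Q)
  congOnDouble a b a<N b<N with half a | half b
  ... | twice x   | twice y   =
    trans (∪ᵖ-even-even P Q x y)
          (trans (e x y (double-cancel-< a<N) (double-cancel-< b<N)) (sym (∪ᵖ-even-even P′ Q x y)))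
  ... | twice+1 x | twice+1 y = trans (∪ᵖ-odd-odd P Q x y) (sym (∪ᵖ-odd-odd P′ Q x y))
  ... | twice x   | twice+1 y = trans (∪ᵖ-even-odd P Q x y) (sym (∪ᵖ-even-odd P′ Q x y))
  ... | twice+1 x | twice y   = trans (∪ᵖ-odd-even P Q x y) (sym (∪ᵖ-odd-even P′ Q x y))

IsKreweras-resp-EqOn : ∀ {n} {P P′ Q : NCP n} → EqOn n (proj₁ P) (proj₁ P′) →
  IsKreweras n P Q → IsKreweras n P′ Q
IsKreweras-resp-EqOn {n} {P} {P′} {Q} e (nc , greatest) =
    NonCrossing-resp-EqOn (∪ᵖ-congˡ n (proj₁ Q) e) nc
  , λ Q′ nc′ → greatest Q′ (NonCrossing-resp-EqOn (∪ᵖ-congˡ n (proj₁ Q′) (EqOn-sym e)) nc′)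

evenPart-concat : ∀ m {K} A B →
  EqOn (suc m + K) (evenPart (concat (suc (double m)) A B))
                   (concat (suc m) (evenPart A) (oddPart B))
evenPart-concat m A B =
  concat-reindex double (suc ∘ double) A B
    (λ a<M → s≤s (double-mono-≤ (≤-pred a<M))) (double-suc-+ m)

oddPart-concat : ∀ m {K} A B →
  EqOn (m + K) (oddPart (concat (suc (double m)) A B)) (concat m (oddPart A) (evenPart B))
oddPart-concat m A B =
  concat-reindex (suc ∘ double) double A B (s≤s ∘ double-mono-<) (cong suc ∘ double-+ m)

evenPart-prependToLast : ∀ m X →
  EqOn (suc m) (evenPart (prependToLast (double m) X)) (prependToLast m (oddPart X))
evenPart-prependToLast m       X zero    zero    _        _        = refl
evenPart-prependToLast zero    X zero    (suc b) _        (s≤s ())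
evenPart-prependToLast zero    X (suc a) _       (s≤s ()) _
evenPart-prependToLast (suc m) X zero    (suc b) _        _        = refl
evenPart-prependToLast (suc m) X (suc a) zero    _        _        = refl
evenPart-prependToLast m       X (suc a) (suc b) _        _        = refl

evenPart-ψ : ∀ σ τ → EqOn (size (σ ∨ᵗ τ)) (evenPart (ψ (σ ∨ᵗ τ)))
  (concat (suc (size σ)) (prependToLast (size σ) (oddPart (ψ σ))) (evenPart (ψ τ)))
evenPart-ψ σ τ =
  EqOn-trans (evenPart-concat (size σ) (prependToLast (double (size σ)) (ψ σ)) Bτ)
    (concat-cong (suc (size σ)) (size τ) {B = evenPart (ψ τ)}
      (evenPart-prependToLast (size σ) (ψ σ)) EqOn-refl)
  where
  Bτ : Rel₂
  Bτ = prependToLast (double (size τ)) (ψ τ)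

oddPart-ψ : ∀ σ τ → EqOn (size (σ ∨ᵗ τ)) (oddPart (ψ (σ ∨ᵗ τ)))
  (concat (size σ) (evenPart (ψ σ)) (prependToLast (size τ) (oddPart (ψ τ))))
oddPart-ψ σ τ = EqOn-subst (+-suc (size σ) (size τ))
  (EqOn-trans (oddPart-concat (size σ) Aσ (prependToLast (double (size τ)) (ψ τ)))
    (concat-cong (size σ) (suc (size τ)) {A = evenPart (ψ σ)}
      EqOn-refl (evenPart-prependToLast (size τ) (ψ τ))))
  where
  Aσ : Rel₂
  Aσ = prependToLast (double (size σ)) (ψ σ)

-- Every noncrossing partition is a part of some φ (R τ)

lastTrue : ∀ (f : ℕ → Bool) N → f 0 ≡ true →
  Σ ℕ λ m → m ≤ N × f m ≡ true × (∀ b → m < b → b ≤ N → f b ≡ false)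
lastTrue f zero    f0 = 0 , z≤n , f0 , λ b 0<b b≤0 → ⊥-elim (<⇒≱ 0<b b≤0)
lastTrue f (suc N) f0 with f (suc N) in fN
... | true  = suc N , ≤-refl , fN , λ b N<b b≤N → ⊥-elim (<⇒≱ N<b b≤N)
... | false with lastTrue f N f0
...   | m , m≤N , fm , after = m , m≤n⇒m≤1+n m≤N , fm , after′
  where
  after′ : ∀ b → m < b → b ≤ suc N → f b ≡ false
  after′ b m<b b≤N with m≤n⇒m<n∨m≡n b≤N
  ... | inj₁ b<N  = after b m<b (≤-pred b<N)
  ... | inj₂ refl = fN

firstTrue : ∀ (f : ℕ → Bool) N → f N ≡ true →
  Σ ℕ λ m → m ≤ N × f m ≡ true × (∀ b → b < m → f b ≡ false)
firstTrue f zero    fN = 0 , z≤n , fN , λ b ()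
firstTrue f (suc N) fN with f 0 in f0
... | true  = 0 , z≤n , f0 , λ b ()
... | false with firstTrue (f ∘ suc) N fN
...   | m , m≤N , fm , before = suc m , s≤s m≤N , fm , before′
  where
  before′ : ∀ b → b < suc m → f b ≡ false
  before′ zero    _         = f0
  before′ (suc b) (s≤s b<m) = before b b<m

split-after-block-of-0 : ∀ {n r} → IsPartition (suc n) r → NonCrossing (suc n) r →
  Σ ℕ λ m → Σ ℕ λ k → m + k ≡ n ×
    EqOn (suc n) r (concat (suc m) (prependToLast m (shift 1 r)) (shift (suc m) r))
split-after-block-of-0 {n} {r} isr ncr with lastTrue (r 0) n (isr .refl′ 0 z<s)
... | m , m≤n , r0m , after with m≤n⇒∃[o]m+o≡n m≤n
... | k , refl = m , k , refl , EqOn-trans (concat-split (suc m) isr cut)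
  (concat-cong (suc m) k {B = shift (suc m) r}
    (EqOn-sym (prependToLast-shift m (shift-isPartition 0 (suc m) (s≤s m≤n) isr) r0m)) EqOn-refl)
  where
  joined-to-0 : ∀ {a} b → a < suc m → suc m + b < suc n → r a (suc m + b) ≡ true → r 0 a ≡ true
  joined-to-0 {zero}  b _         _   _ = isr .refl′ 0 z<s
  joined-to-0 {suc a} b (s≤s a<m) b<N h with m≤n⇒m<n∨m≡n a<m
  ... | inj₂ refl = r0m
  ... | inj₁ sa<m = ncr 0 (suc a) m (suc m + b) z<s sa<m (s≤s (m≤m+n m b)) b<N r0m h
  cut : ∀ {a} b → a < suc m → suc m + b < suc n → r a (suc m + b) ≡ false
  cut {a} b a<sm b<N = ¬-not λ h →
    not-¬ (isr .trans′ 0 a _ z<s (<-≤-trans a<sm (s≤s m≤n)) b<N (joined-to-0 b a<sm b<N h) h)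
          (after (suc m + b) (s≤s (m≤m+n m b)) (≤-pred b<N))

split-before-block-of-last : ∀ {n r} → IsPartition (suc n) r → NonCrossing (suc n) r →
  Σ ℕ λ m → Σ ℕ λ k → m + k ≡ n ×
    EqOn (suc n) r (concat m r (prependToLast k (shift 1 (shift m r))))
split-before-block-of-last {n} {r} isr ncr with firstTrue (λ x → r x n) n (isr .refl′ n ≤-refl)
... | m , m≤n , rmn , before with m≤n⇒∃[o]m+o≡n m≤n
... | k , refl = m , k , refl , EqOn-trans (concat-split m isr cut)
  (EqOn-subst (+-suc m k) (concat-cong m (suc k) {A = r}
    EqOn-refl (EqOn-sym (prependToLast-shift k shift-isP shift0k))))
  where
  shift-isP : IsPartition (suc k) (shift m r)
  shift-isP = shift-isPartition m (suc k) (≤-reflexive (+-suc m k)) isr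
  shift0k : shift m r 0 k ≡ true
  shift0k = subst (λ z → r z (m + k) ≡ true) (sym (+-identityʳ m)) rmn
  m<N : m < suc (m + k)
  m<N = s≤s m≤n
  joined-to-m : ∀ {a} b → a < m → m + b < m + k → r a (m + b) ≡ true → r a m ≡ true
  joined-to-m {a} zero    _   _     h = subst (λ z → r a z ≡ true) (+-identityʳ m) h
  joined-to-m     (suc b) a<m m+b<n h = ncr _ m _ (m + k) a<m (m<m+n m z<s) m+b<n ≤-refl h rmn
  joined-to-last : ∀ {a} b → a < m → m + b < suc (m + k) → r a (m + b) ≡ true → r a (m + k) ≡ true
  joined-to-last {a} b a<m b<N h with m<1+n⇒m<n∨m≡n b<N
  ... | inj₂ m+b≡m+k = subst (λ z → r a z ≡ true) m+b≡m+k h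
  ... | inj₁ m+b<m+k =
    isr .trans′ a m (m + k) (<-trans a<m m<N) m<N ≤-refl (joined-to-m b a<m m+b<m+k h) rmn
  cut : ∀ {a} b → a < m → m + b < suc (m + k) → r a (m + b) ≡ false
  cut {a} b a<m b<N = ¬-not λ h → not-¬ (joined-to-last b a<m b<N h) (before a a<m)

Exhausts : (Rel₂ → Rel₂) → ℕ → Set
Exhausts part n = (P : NCP n) → ∃[ τ ] (size τ ≡ n × EqOn n (proj₁ P) (part (ψ τ)))

module _ (n : ℕ) (IH : ∀ {j} → j < suc n → Exhausts evenPart j × Exhausts oddPart j) where

  evenPart-exhausts-suc : Exhausts evenPart (suc n)
  evenPart-exhausts-suc P@(r , isr , ncr) with split-after-block-of-0 isr ncr
  ... | m , k , refl , r≈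
    with proj₂ (IH (s≤s (m≤m+n m k))) (shiftNCP 1 m (s≤s (m≤m+n m k)) P)
       | proj₁ (IH (s≤s (m≤n+m k m))) (shiftNCP (suc m) k ≤-refl P)
  ... | σ , refl , eσ | τ , refl , eτ =
    σ ∨ᵗ τ , refl ,
    EqOn-trans r≈ (EqOn-trans (concat-cong (suc m) k (prependToLast-cong m eσ) eτ)
                              (EqOn-sym (evenPart-ψ σ τ)))

  oddPart-exhausts-suc : Exhausts oddPart (suc n)
  oddPart-exhausts-suc P@(r , isr , ncr) with split-before-block-of-last isr ncr
  ... | m , k , refl , r≈
    with proj₁ (IH (s≤s (m≤m+n m k))) (shiftNCP 0 m (m≤n⇒m≤1+n (m≤m+n m k)) P)
       | proj₂ (IH (s≤s (m≤n+m k m)))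
               (shiftNCP 1 k ≤-refl (shiftNCP m (suc k) (≤-reflexive (+-suc m k)) P))
  ... | σ , refl , eσ | τ , refl , eτ =
    σ ∨ᵗ τ , refl ,
    EqOn-trans r≈
      (EqOn-trans (EqOn-subst (+-suc m k) (concat-cong m (suc k) eσ (prependToLast-cong k eτ)))
                  (EqOn-sym (oddPart-ψ σ τ)))

parts-exhaust : ∀ n → Exhausts evenPart n × Exhausts oddPart n
parts-exhaust = <-rec _ step
  where
  step : ∀ n → (∀ {j} → j < n → Exhausts evenPart j × Exhausts oddPart j) →
    Exhausts evenPart n × Exhausts oddPart n
  step zero    _  = (λ _ → leaf , refl , λ _ _ ()) , (λ _ → leaf , refl , λ _ _ ())
  step (suc n) IH = evenPart-exhausts-suc n IH , oddPart-exhausts-suc n IH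

φ∘R≈parts : ∀ τ → EqOn (size τ + size τ) (φ (R τ)) (evenPart (ψ τ) ∪ᵖ oddPart (ψ τ))
φ∘R≈parts τ = EqOn-subst (double≡+ (size τ))
  (EqOn-trans (φ∘R≈ψ τ) (≈evenPart∪oddPart (ψ-isKrewerasUnion τ)))

φ∘R-kreweras : ∀ n τ → size τ ≡ n →
  ∃[ P ] ∃[ Q ] (IsKreweras n P Q × EqOn (n + n) (φ (R τ)) (proj₁ P ∪ᵖ proj₁ Q))
φ∘R-kreweras .(size τ) τ refl = evenPartNCP K , oddPartNCP K , isKreweras K , φ∘R≈parts τ
  where
  K : IsKrewerasUnion (double (size τ)) (ψ τ)
  K = ψ-isKrewerasUnion τ

kreweras-φ∘R : ∀ n (P : NCP n) →
  ∃[ Q ] (IsKreweras n P Q × ∃[ τ ] (size τ ≡ n × EqOn (n + n) (φ (R τ)) (proj₁ P ∪ᵖ proj₁ Q)))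
kreweras-φ∘R n P with proj₁ (parts-exhaust n) P
... | τ , refl , P≈ =
  oddPartNCP K ,
  IsKreweras-resp-EqOn {P = evenPartNCP K} {P′ = P} {Q = oddPartNCP K}
    (EqOn-sym P≈) (isKreweras K) ,
  τ , refl , EqOn-trans (φ∘R≈parts τ) (∪ᵖ-congˡ (size τ) (oddPart (ψ τ)) (EqOn-sym P≈))
  where
  K : IsKrewerasUnion (double (size τ)) (ψ τ)
  K = ψ-isKrewerasUnion τ

proposition3p14 : (n : ℕ) →
    ((τ : Tree) → size τ ≡ n →
       ∃[ P ] ∃[ Q ] (IsKreweras n P Q ×
         EqOn (n + n) (φ (R τ)) (proj₁ P ∪ᵖ proj₁ Q)))
    ×
    ((P : NCP n) →
       ∃[ Q ] (IsKreweras n P Q ×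
         ∃[ τ ] (size τ ≡ n × EqOn (n + n) (φ (R τ)) (proj₁ P ∪ᵖ proj₁ Q))))
proposition3p14 n = φ∘R-kreweras n , kreweras-φ∘R n
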